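{- If $G$ and $H$ are bypass over-visible graphs, then $\mu_{\rm t}(G\,\square\,H)>\mu_{\rm t}(G)\,\mu_{\rm t}(H)$.
   Context: All graphs are finite, simple and connected. For $X\subseteq V(G)$, two vertices $x,y$ are $X$-visible if there is a shortest $x,y$-path $P$ with $V(P)\cap X\subseteq\{x,y\}$; $X$ is a total mutual-visibility set if every pair of vertices of $G$ is $X$-visible. $\mu_{\rm t}(G)$ is the largest cardinality of a total mutual-visibility set of $G$, and a $\mu_{\rm t}$-set is a total mutual-visibility set of that cardinality. A subgraph $H$ of $G$ is convex if for all $x,y\in V(H)$ every shortest $x,y$-path of $G$ lies in $H$. A vertex is a bypass vertex if it is not the middle vertex of a convex $P_3$ in $G$. A graph $G$ is bypass over-visible if it contains an independent set $U$ consisting of bypass vertices such that $U$ contains some $\mu_{\rm t}$-set $U'$ of $G$ as a proper subset ($U'\subsetneq U$). The Cartesian product $G\,\square\,H$ has vertex set $V(G)\times V(H)$, with $(g,h)$ adjacent to $(g',h')$ iff either $gg'\in E(G)$ and $h=h'$, or $g=g'$ and $hh'\in E(H)$. -}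

module Defs where

open import Data.Nat using (ℕ; zero; suc; _*_; _≤_; _<_)
open import Data.Fin using (Fin; zero; suc; inject₁; fromℕ; remQuot; _≟_)
open import Data.Fin.Subset using (Subset; _∈_; _∉_; _⊂_; ∣_∣)
open import Data.Vec using (Vec; lookup)
open import Data.Bool using (Bool; true; false; _∧_; _∨_)
open import Data.Product using (Σ; ∃; ∃-syntax; _×_; _,_; proj₁; proj₂)
open import Data.Sum using (_⊎_)
open import Relation.Nullary using (¬_)
open import Relation.Nullary.Decidable using (⌊_⌋)
open import Relation.Binary.PropositionalEquality using (_≡_; _≢_)

record Graph : Set where
  constructor mkGraph
  field
    n   : ℕ
    adj : Fin n → Fin n → Bool
open Graph public

Vertex : Graph → Set
Vertex G = Fin (n G)

Adj : (G : Graph) → Vertex G → Vertex G → Set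
Adj G u v = adj G u v ≡ true

IsSimple : Graph → Set
IsSimple G = (∀ u → ¬ Adj G u u) × (∀ u v → Adj G u v → Adj G v u)

IsWalk : (G : Graph) → Vertex G → Vertex G → (k : ℕ) → Vec (Vertex G) (suc k) → Set
IsWalk G x y k P =
  lookup P zero ≡ x × lookup P (fromℕ k) ≡ y ×
  (∀ (i : Fin k) → Adj G (lookup P (inject₁ i)) (lookup P (suc i)))

IsConnected : Graph → Set
IsConnected G = ∀ x y → ∃[ k ] ∃[ P ] IsWalk G x y k P

-- A shortest x,y-path: a walk from x to y of minimum length
-- (such a walk is necessarily a path).
IsShortestPath : (G : Graph) → Vertex G → Vertex G → (k : ℕ) → Vec (Vertex G) (suc k) → Set
IsShortestPath G x y k P =
  IsWalk G x y k P × (∀ j (Q : Vec (Vertex G) (suc j)) → IsWalk G x y j Q → k ≤ j)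

Visible : (G : Graph) → Subset (n G) → Vertex G → Vertex G → Set
Visible G X x y = ∃[ k ] ∃[ P ] (IsShortestPath G x y k P ×
  (∀ (i : Fin (suc k)) → lookup P i ∈ X → lookup P i ≡ x ⊎ lookup P i ≡ y))

IsTotalMutualVisibility : (G : Graph) → Subset (n G) → Set
IsTotalMutualVisibility G X = ∀ x y → Visible G X x y

IsMuT : Graph → ℕ → Set
IsMuT G k =
  (∃[ X ] (IsTotalMutualVisibility G X × ∣ X ∣ ≡ k)) ×
  (∀ X → IsTotalMutualVisibility G X → ∣ X ∣ ≤ k)

IsMuTSet : (G : Graph) → Subset (n G) → Set
IsMuTSet G X =
  IsTotalMutualVisibility G X × (∀ Y → IsTotalMutualVisibility G Y → ∣ Y ∣ ≤ ∣ X ∣)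

record Subgraph (G : Graph) : Set₁ where
  field
    VH : Vertex G → Set
    EH : Vertex G → Vertex G → Set
open Subgraph public

LiesIn : (G : Graph) (H : Subgraph G) (k : ℕ) → Vec (Vertex G) (suc k) → Set
LiesIn G H k P =
  (∀ (i : Fin (suc k)) → VH H (lookup P i)) ×
  (∀ (i : Fin k) → EH H (lookup P (inject₁ i)) (lookup P (suc i)))

IsConvex : (G : Graph) → Subgraph G → Set
IsConvex G H = ∀ x y → VH H x → VH H y →
  ∀ k (P : Vec (Vertex G) (suc k)) → IsShortestPath G x y k P → LiesIn G H k P

IsP3 : (G : Graph) → Vertex G → Vertex G → Vertex G → Set
IsP3 G u v w = Adj G u v × Adj G v w × u ≢ w

P3Subgraph : (G : Graph) → Vertex G → Vertex G → Vertex G → Subgraph G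
P3Subgraph G u v w = record
  { VH = λ z → z ≡ u ⊎ z ≡ v ⊎ z ≡ w
  ; EH = λ a b → (a ≡ u × b ≡ v) ⊎ (a ≡ v × b ≡ u) ⊎ (a ≡ v × b ≡ w) ⊎ (a ≡ w × b ≡ v)
  }

IsBypass : (G : Graph) → Vertex G → Set
IsBypass G v = ¬ (∃[ u ] ∃[ w ] (IsP3 G u v w × IsConvex G (P3Subgraph G u v w)))

IsIndependent : (G : Graph) → Subset (n G) → Set
IsIndependent G U = ∀ x y → x ∈ U → y ∈ U → ¬ Adj G x y

IsBypassOverVisible : Graph → Set
IsBypassOverVisible G = ∃[ U ] (IsIndependent G U × (∀ x → x ∈ U → IsBypass G x) ×
  ∃[ U' ] (IsMuTSet G U' × U' ⊂ U))

-- Cartesian product: vertex (g,h) is encoded as an element of Fin (n G * n H)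
-- via Data.Fin.remQuot / combine.
_□_ : Graph → Graph → Graph
G □ H = mkGraph (n G * n H) λ i j →
  let gh  = remQuot {n G} (n H) i
      gh' = remQuot {n G} (n H) j
      g = proj₁ gh ; h = proj₂ gh ; g' = proj₁ gh' ; h' = proj₂ gh'
  in (adj G g g' ∧ ⌊ h ≟ h' ⌋) ∨ (⌊ g ≟ g' ⌋ ∧ adj H h h')

-- Let A, B be μ_t-sets of G, H lying properly inside independent sets of bypass vertices, and
-- pick vertices u ∉ A, v ∉ B of those independent sets.  Then X = (A × B) ∪ {(u , v)} is a total
-- mutual-visibility set of G □ H with |A| |B| + 1 elements.  A geodesic of G □ H may run along a
-- G-fibre and then along an H-fibre.  Each fibre meets X either in a copy of A (or B) or in at
-- most the vertex u (or v); in the latter case a geodesic with u at most at its ends exists,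
-- since u is not the middle of a convex P₃ and so can be replaced by another common neighbour of
-- its two neighbours on the geodesic.  Such a two-leg path is blocked only at its corner.  When
-- both possible corners lie in X, first step from (g , h) to a G-neighbour p of g on a geodesic:
-- p lies outside the independent set, so the H-fibre through p avoids X.

module Submission where

open import Defs
open import Data.Nat using (ℕ; zero; suc; _+_; _*_; _≤_; _<_; z≤n; s≤s)
open import Data.Nat.Properties
  using (≤-refl; ≤-trans; n≤1+n; ≤-pred; <⇒≱; +-suc; +-comm; +-mono-≤; *-mono-≤; module ≤-Reasoning)
open import Data.Fin using (Fin; zero; suc; inject₁; fromℕ; _≟_; combine; remQuot; _↑ˡ_; _↑ʳ_)
open import Data.Fin.Properties using (any?; remQuot-combine; combine-remQuot; combine-injective)
open import Data.Fin.Subset using (Subset; inside; outside; ⊥; ⁅_⁆; _∪_; _∈_; _∉_; _⊆_; ∣_∣)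
open import Data.Fin.Subset.Properties
  using (_∈?_; ∉⊥; ∣⊥∣≡0; x∈⁅x⁆; x∈⁅y⁆⇒x≡y; p⊆p∪q; x∈p∪q⁺; x∈p∪q⁻; p⊂q⇒∣p∣<∣q∣)
open import Data.Vec using (Vec; lookup; _∷_; []; _++_; here; there)
open import Data.Bool using (true)
import Data.Bool as Bool
open import Data.Bool.Properties using (T-≡; T-∧; T-∨)
open import Data.Product using (Σ; ∃-syntax; _×_; _,_; proj₁; proj₂; map₁)
open import Data.Sum using (_⊎_; inj₁; inj₂; [_,_])
import Data.Sum as Sum
open import Data.Empty using (⊥-elim)
open import Function using (_∘_)
open import Function.Bundles using (Equivalence)
open import Relation.Nullary using (¬_; Dec; yes; no)
open import Relation.Nullary.Decidable using (_×-dec_; ¬?; decidable-stable; toWitness; fromWitness)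
open import Relation.Binary.PropositionalEquality
  using (_≡_; _≢_; refl; sym; trans; cong; cong₂; subst; subst₂)

open Equivalence using (to; from)

infixr 5 _◅_

Unblocking : {V : Set} → (V → Set) → V → V → V → Set
Unblocking S x y p = S p → p ≡ x ⊎ p ≡ y

data Walk (G : Graph) : Vertex G → Vertex G → ℕ → Set where
  ε   : ∀ {x} → Walk G x x 0
  _◅_ : ∀ {x y z k} → Adj G x y → Walk G y z k → Walk G x z (suc k)

DistAtLeast : (G : Graph) → Vertex G → Vertex G → ℕ → Set
DistAtLeast G x y k = ∀ j → Walk G x y j → k ≤ j

module _ {G : Graph} where

  vertices : ∀ {x y k} → Walk G x y k → Vec (Vertex G) (suc k)
  vertices {x} ε       = x ∷ []
  vertices {x} (_ ◅ w) = x ∷ vertices w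

  lookup-vertices-first : ∀ {x y k} (w : Walk G x y k) → lookup (vertices w) zero ≡ x
  lookup-vertices-first ε       = refl
  lookup-vertices-first (_ ◅ w) = refl

  lookup-vertices-last : ∀ {x y k} (w : Walk G x y k) → lookup (vertices w) (fromℕ k) ≡ y
  lookup-vertices-last ε       = refl
  lookup-vertices-last (_ ◅ w) = lookup-vertices-last w

  vertices-isWalk : ∀ {x y k} (w : Walk G x y k) → IsWalk G x y k (vertices w)
  vertices-isWalk w = lookup-vertices-first w , lookup-vertices-last w , edges w
    where
    edges : ∀ {x y k} (w : Walk G x y k) (i : Fin k) →
      Adj G (lookup (vertices w) (inject₁ i)) (lookup (vertices w) (suc i))
    edges (e ◅ w) zero    = subst (Adj G _) (sym (lookup-vertices-first w)) e
    edges (_ ◅ w) (suc i) = edges w i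

  fromIsWalk : ∀ {x y k} (P : Vec (Vertex G) (suc k)) → IsWalk G x y k P →
    Σ (Walk G x y k) λ w → vertices w ≡ P
  fromIsWalk {k = k} P (refl , refl , es) = fromEdges k P es
    where
    fromEdges : ∀ k (P : Vec (Vertex G) (suc k)) →
      (∀ (i : Fin k) → Adj G (lookup P (inject₁ i)) (lookup P (suc i))) →
      Σ (Walk G (lookup P zero) (lookup P (fromℕ k)) k) λ w → vertices w ≡ P
    fromEdges zero    (p ∷ []) _  = ε , refl
    fromEdges (suc k) (p ∷ P)  es with fromEdges k P (λ i → es (suc i))
    ... | w , w≡P = es zero ◅ w , cong (p ∷_) w≡P

  infixr 5 _◅◅_

  _◅◅_ : ∀ {x y z k l} → Walk G x y k → Walk G y z l → Walk G x z (k + l)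
  ε       ◅◅ w' = w'
  (e ◅ w) ◅◅ w' = e ◅ (w ◅◅ w')

  AllVertices : (Vertex G → Set) → ∀ {x y k} → Walk G x y k → Set
  AllVertices P {x} ε       = P x
  AllVertices P {x} (_ ◅ w) = P x × AllVertices P w

  AllVertices⇒lookup : ∀ {P x y k} (w : Walk G x y k) → AllVertices P w →
    ∀ i → P (lookup (vertices w) i)
  AllVertices⇒lookup ε       p        zero    = p
  AllVertices⇒lookup (_ ◅ w) (p , _)  zero    = p
  AllVertices⇒lookup (_ ◅ w) (_ , ps) (suc i) = AllVertices⇒lookup w ps i

  lookup⇒AllVertices : ∀ {P x y k} (w : Walk G x y k) →
    (∀ i → P (lookup (vertices w) i)) → AllVertices P w
  lookup⇒AllVertices ε       f = f zero
  lookup⇒AllVertices (_ ◅ w) f = f zero , lookup⇒AllVertices w (λ i → f (suc i))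

  AllVertices-map : ∀ {P Q} → (∀ {p} → P p → Q p) →
    ∀ {x y k} (w : Walk G x y k) → AllVertices P w → AllVertices Q w
  AllVertices-map f ε       p        = f p
  AllVertices-map f (_ ◅ w) (p , ps) = f p , AllVertices-map f w ps

  AllVertices-universal : ∀ {P : Vertex G → Set} → (∀ p → P p) →
    ∀ {x y k} (w : Walk G x y k) → AllVertices P w
  AllVertices-universal f ε       = f _
  AllVertices-universal f (_ ◅ w) = f _ , AllVertices-universal f w

  AllVertices-zip : ∀ {P Q x y k} (w : Walk G x y k) → AllVertices P w → AllVertices Q w →
    AllVertices (λ p → P p × Q p) w
  AllVertices-zip ε       p        q        = p , q
  AllVertices-zip (_ ◅ w) (p , ps) (q , qs) = (p , q) , AllVertices-zip w ps qs

  AllVertices-◅◅ : ∀ {P x y z k l} (w : Walk G x y k) (w' : Walk G y z l) →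
    AllVertices P w → AllVertices P w' → AllVertices P (w ◅◅ w')
  AllVertices-◅◅ ε       w' _        ps' = ps'
  AllVertices-◅◅ (_ ◅ w) w' (p , ps) ps' = p , AllVertices-◅◅ w w' ps ps'

  shortestPath⇒DistAtLeast : ∀ {x y k} P → IsShortestPath G x y k P → DistAtLeast G x y k
  shortestPath⇒DistAtLeast _ (_ , shortest) j w = shortest j (vertices w) (vertices-isWalk w)

  DistAtLeast-◅ : ∀ {x y z k} → Adj G x y → DistAtLeast G x z (suc k) → DistAtLeast G y z k
  DistAtLeast-◅ e d j w = ≤-pred (d (suc j) (e ◅ w))

  vertices-reach-end : ∀ {x z k} (w : Walk G x z k) → AllVertices (λ p → ∃[ j ] (j ≤ k × Walk G p z j)) w
  vertices-reach-end ε = 0 , z≤n , ε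
  vertices-reach-end {k = suc k} (e ◅ w) =
    (suc k , ≤-refl , e ◅ w) ,
    AllVertices-map (λ (j , j≤k , w') → j , ≤-trans j≤k (n≤1+n k) , w') w (vertices-reach-end w)

  geodesic-avoids-start : ∀ {x y z k} → Adj G x y → (w : Walk G y z k) →
    DistAtLeast G x z (suc k) → AllVertices (_≢ x) w
  geodesic-avoids-start e w d = AllVertices-map returns w (vertices-reach-end w)
    where
    returns : ∀ {p} → ∃[ j ] (j ≤ _ × Walk G p _ j) → p ≢ _
    returns (j , j≤k , w') refl = <⇒≱ (s≤s j≤k) (d j w')

  Clear : (Vertex G → Set) → ∀ {x y k} → Walk G x y k → Set
  Clear S {x} {y} = AllVertices (Unblocking S x y)

  Clear-transfer : ∀ {x y a b k} S (w : Walk G a b k) →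
    Unblocking S x y a → Unblocking S x y b → Clear S w → AllVertices (Unblocking S x y) w
  Clear-transfer S w unblock-a unblock-b =
    AllVertices-map (λ clear s → [ (λ { refl → unblock-a s }) , (λ { refl → unblock-b s }) ] (clear s)) w

ClearGeodesic : (G : Graph) → (Vertex G → Set) → Vertex G → Vertex G → Set
ClearGeodesic G S x y = ∃[ k ] Σ (Walk G x y k) λ w → DistAtLeast G x y k × Clear S w

module _ {G : Graph} where

  ClearGeodesic-mono : ∀ {S S' x y} → (∀ {p} → S' p → S p) →
    ClearGeodesic G S x y → ClearGeodesic G S' x y
  ClearGeodesic-mono S'⊆S (k , w , d , c) = k , w , d , AllVertices-map (_∘ S'⊆S) w c

  visible⇒ClearGeodesic : ∀ {X x y} → Visible G X x y → ClearGeodesic G (_∈ X) x y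
  visible⇒ClearGeodesic (k , P , shortest@(isWalk , _) , clear) with fromIsWalk {G = G} P isWalk
  ... | w , refl =
    k , w , shortestPath⇒DistAtLeast (vertices w) shortest , lookup⇒AllVertices w clear

  ClearGeodesic⇒visible : ∀ {X x y} → ClearGeodesic G (_∈ X) x y → Visible G X x y
  ClearGeodesic⇒visible (k , w , d , c) =
    k , vertices w , (vertices-isWalk w , λ j Q isWalk → d j (proj₁ (fromIsWalk {G = G} Q isWalk))) ,
    AllVertices⇒lookup w c

module _ {G : Graph} (simple : IsSimple G) where

  private
    irrefl : ∀ {u} → ¬ Adj G u u
    irrefl = proj₁ simple _

    adj-sym : ∀ {u v} → Adj G u v → Adj G v u
    adj-sym = proj₂ simple _ _

  P3-convex : ∀ {a b c} → Adj G a b → Adj G b c → a ≢ c → ¬ Adj G a c →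
    (∀ m → Adj G a m → Adj G m c → m ≡ b) → IsConvex G (P3Subgraph G a b c)
  P3-convex {a} {b} {c} ab bc a≢c a≁c unique x y x∈ y∈ k P shortest@((_ , _ , steps) , _) =
    ∈S , λ i → edge (∈S _) (∈S _) (steps i)
    where
    S = VH (P3Subgraph G a b c)

    edge : ∀ {x y} → S x → S y → Adj G x y → EH (P3Subgraph G a b c) x y
    edge (inj₁ refl)        (inj₁ refl)        e = ⊥-elim (irrefl e)
    edge (inj₁ refl)        (inj₂ (inj₁ refl)) e = inj₁ (refl , refl)
    edge (inj₁ refl)        (inj₂ (inj₂ refl)) e = ⊥-elim (a≁c e)
    edge (inj₂ (inj₁ refl)) (inj₁ refl)        e = inj₂ (inj₁ (refl , refl))
    edge (inj₂ (inj₁ refl)) (inj₂ (inj₁ refl)) e = ⊥-elim (irrefl e)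
    edge (inj₂ (inj₁ refl)) (inj₂ (inj₂ refl)) e = inj₂ (inj₂ (inj₁ (refl , refl)))
    edge (inj₂ (inj₂ refl)) (inj₁ refl)        e = ⊥-elim (a≁c (adj-sym e))
    edge (inj₂ (inj₂ refl)) (inj₂ (inj₁ refl)) e = inj₂ (inj₂ (inj₂ (refl , refl)))
    edge (inj₂ (inj₂ refl)) (inj₂ (inj₂ refl)) e = ⊥-elim (irrefl e)

    to-b : ∀ {x} → S x → ∃[ j ] (j ≤ 1 × Walk G x b j)
    to-b (inj₁ refl)        = 1 , ≤-refl , ab ◅ ε
    to-b (inj₂ (inj₁ refl)) = 0 , z≤n , ε
    to-b (inj₂ (inj₂ refl)) = 1 , ≤-refl , adj-sym bc ◅ ε

    from-b : ∀ {x} → S x → ∃[ j ] (j ≤ 1 × Walk G b x j)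
    from-b (inj₁ refl)        = 1 , ≤-refl , adj-sym ab ◅ ε
    from-b (inj₂ (inj₁ refl)) = 0 , z≤n , ε
    from-b (inj₂ (inj₂ refl)) = 1 , ≤-refl , bc ◅ ε

    within-two : ∀ {x y} → S x → S y → ∃[ j ] (j ≤ 2 × Walk G x y j)
    within-two x∈ y∈ with to-b x∈ | from-b y∈
    ... | j , j≤1 , w | j' , j'≤1 , w' = _ , +-mono-≤ j≤1 j'≤1 , w ◅◅ w'

    ends : ∀ {x y} → S x → S y → x ≢ y → ¬ Adj G x y → (x ≡ a × y ≡ c) ⊎ (x ≡ c × y ≡ a)
    ends (inj₁ refl)        (inj₁ refl)        x≢y _   = ⊥-elim (x≢y refl)
    ends (inj₁ refl)        (inj₂ (inj₁ refl)) _   x≁y = ⊥-elim (x≁y ab)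
    ends (inj₁ refl)        (inj₂ (inj₂ refl)) _   _   = inj₁ (refl , refl)
    ends (inj₂ (inj₁ refl)) (inj₁ refl)        _   x≁y = ⊥-elim (x≁y (adj-sym ab))
    ends (inj₂ (inj₁ refl)) (inj₂ (inj₁ refl)) x≢y _   = ⊥-elim (x≢y refl)
    ends (inj₂ (inj₁ refl)) (inj₂ (inj₂ refl)) _   x≁y = ⊥-elim (x≁y bc)
    ends (inj₂ (inj₂ refl)) (inj₁ refl)        _   _   = inj₂ (refl , refl)
    ends (inj₂ (inj₂ refl)) (inj₂ (inj₁ refl)) _   x≁y = ⊥-elim (x≁y (adj-sym bc))
    ends (inj₂ (inj₂ refl)) (inj₂ (inj₂ refl)) x≢y _   = ⊥-elim (x≢y refl)

    middle : ∀ {x y m} → S x → S y → x ≢ y → ¬ Adj G x y → Adj G x m → Adj G m y → m ≡ b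
    middle x∈ y∈ x≢y x≁y xm my with ends x∈ y∈ x≢y x≁y
    ... | inj₁ (refl , refl) = unique _ xm my
    ... | inj₂ (refl , refl) = unique _ (adj-sym my) (adj-sym xm)

    vertices-in-S : ∀ {x y} k (P : Vec (Vertex G) (suc k)) → S x → S y →
      IsShortestPath G x y k P → ∀ i → S (lookup P i)
    vertices-in-S 0 (p ∷ []) x∈ _ ((refl , refl , _) , _) zero = x∈
    vertices-in-S 1 (p ∷ q ∷ []) x∈ y∈ ((refl , refl , _) , _) = λ { zero → x∈ ; (suc zero) → y∈ }
    vertices-in-S 2 (p ∷ m ∷ q ∷ []) x∈ y∈ shortest@((refl , refl , steps) , _) =
      λ { zero → x∈ ; (suc zero) → inj₂ (inj₁ m≡b) ; (suc (suc zero)) → y∈ }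
      where
      dist = shortestPath⇒DistAtLeast (p ∷ m ∷ q ∷ []) shortest
      m≡b : m ≡ b
      m≡b = middle x∈ y∈ (λ { refl → <⇒≱ (s≤s z≤n) (dist 0 ε) })
                         (λ e → <⇒≱ (s≤s (s≤s z≤n)) (dist 1 (e ◅ ε)))
                         (steps zero) (steps (suc zero))
    vertices-in-S (suc (suc (suc k))) P x∈ y∈ shortest with within-two x∈ y∈
    ... | j , j≤2 , w =
      ⊥-elim (<⇒≱ (s≤s j≤2) (≤-trans (s≤s (s≤s (s≤s z≤n))) (shortestPath⇒DistAtLeast P shortest j w)))

    ∈S : ∀ i → S (lookup P i)
    ∈S = vertices-in-S k P x∈ y∈ shortest

  bypass-detour : ∀ {g u z} → IsBypass G u → Adj G g u → Adj G u z → g ≢ z → ¬ Adj G g z →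
    ∃[ m ] (Adj G g m × Adj G m z × m ≢ u)
  bypass-detour {g} {u} {z} bypass gu uz g≢z g≁z
    with any? (λ m → adj? g m ×-dec adj? m z ×-dec ¬? (m ≟ u))
    where
    adj? : ∀ x y → Dec (Adj G x y)
    adj? x y = adj G x y Bool.≟ true
  ... | yes detour = detour
  ... | no no-detour = ⊥-elim (bypass (g , z , (gu , uz , g≢z) , P3-convex gu uz g≢z g≁z unique))
    where
    unique : ∀ m → Adj G g m → Adj G m z → m ≡ u
    unique m gm mz = decidable-stable (m ≟ u) (λ m≢u → no-detour (m , gm , mz , m≢u))

  bypass-reroute : ∀ {u g g' k} → IsBypass G u → (w : Walk G g g' k) → DistAtLeast G g g' k →
    Σ (Walk G g g' k) (Clear (_≡ u))
  bypass-reroute bypass ε _ = ε , (λ _ → inj₁ refl)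
  bypass-reroute {u} bypass (_◅_ {y = y} e w) dist with y ≟ u
  ... | no y≢u =
    let w' , clear = bypass-reroute bypass w (DistAtLeast-◅ e dist)
    in e ◅ w' , (λ _ → inj₁ refl) , AllVertices-map extend w' clear
    where
    extend : ∀ {p} → Unblocking (_≡ u) y _ p → Unblocking (_≡ u) _ _ p
    extend clear refl with clear refl
    ... | inj₁ refl = ⊥-elim (y≢u refl)
    ... | inj₂ u≡g' = inj₂ u≡g'
  ... | yes refl with w
  ...   | ε = e ◅ ε , (λ _ → inj₁ refl) , (λ _ → inj₂ refl)
  ...   | e' ◅ w'' with bypass-detour bypass e e' g≢z g≁z
    where
    g≢z : _ ≢ _
    g≢z refl = <⇒≱ (s≤s (n≤1+n _)) (dist _ w'')
    g≁z : ¬ Adj G _ _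
    g≁z e'' = <⇒≱ ≤-refl (dist _ (e'' ◅ w''))
  ...   | m , gm , mz , m≢u =
    gm ◅ mz ◅ w'' , (λ _ → inj₁ refl) , (λ { refl → ⊥-elim (m≢u refl) }) ,
    AllVertices-map (λ { p≢u refl → ⊥-elim (p≢u refl) }) w''
      (geodesic-avoids-start e' w'' (DistAtLeast-◅ e dist))

  fibre-geodesic : ∀ {A u S} → IsTotalMutualVisibility G A → IsBypass G u →
    ((∀ {p} → S p → p ∈ A) ⊎ (∀ {p} → S p → p ≡ u)) → ∀ g g' → ClearGeodesic G S g g'
  fibre-geodesic visible _ (inj₁ S⊆A) g g' =
    ClearGeodesic-mono S⊆A (visible⇒ClearGeodesic (visible g g'))
  fibre-geodesic visible bypass (inj₂ S⊆u) g g' with visible⇒ClearGeodesic (visible g g')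
  ... | k , w , dist , _ =
    let w' , clear = bypass-reroute bypass w dist in ClearGeodesic-mono S⊆u (k , w' , dist , clear)

module Cartesian (G H : Graph) where

  ⟨_,_⟩ : Vertex G → Vertex H → Vertex (G □ H)
  ⟨_,_⟩ = combine

  coords : Vertex (G □ H) → Vertex G × Vertex H
  coords = remQuot (n H)

  _~□_ : Vertex G × Vertex H → Vertex G × Vertex H → Set
  (g , h) ~□ (g' , h') = (Adj G g g' × h ≡ h') ⊎ (g ≡ g' × Adj H h h')

  adj-□⁻ : ∀ {x z} → Adj (G □ H) x z → coords x ~□ coords z
  adj-□⁻ = Sum.map (λ t → let a , p = to T-∧ t in to T-≡ a , toWitness p)
                   (λ t → let p , a = to T-∧ t in toWitness p , to T-≡ a)
         ∘ to T-∨ ∘ from T-≡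

  adj-□⁺ : ∀ {x z} → coords x ~□ coords z → Adj (G □ H) x z
  adj-□⁺ = to T-≡ ∘ from T-∨
         ∘ Sum.map (λ (a , p) → from T-∧ (from T-≡ a , fromWitness p))
                   (λ (p , a) → from T-∧ (fromWitness p , from T-≡ a))

  adj-□ : ∀ {g g' h h'} → (g , h) ~□ (g' , h') → Adj (G □ H) ⟨ g , h ⟩ ⟨ g' , h' ⟩
  adj-□ {g} {g'} {h} {h'} =
    adj-□⁺ ∘ subst₂ _~□_ (sym (remQuot-combine g h)) (sym (remQuot-combine g' h'))

  project : ∀ {x y j} → Walk (G □ H) x y j →
    ∃[ k ] ∃[ l ] (k + l ≡ j × Walk G (proj₁ (coords x)) (proj₁ (coords y)) k
                             × Walk H (proj₂ (coords x)) (proj₂ (coords y)) l)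
  project ε = 0 , 0 , refl , ε , ε
  project (e ◅ w) with project w | adj-□⁻ e
  ... | k , l , refl , wG , wH | inj₁ (a , h≡h') =
    suc k , l , refl , a ◅ wG , subst (λ h → Walk H h _ l) (sym h≡h') wH
  ... | k , l , refl , wG , wH | inj₂ (g≡g' , a) =
    k , suc l , +-suc k l , subst (λ g → Walk G g _ k) (sym g≡g') wG , a ◅ wH

  DistAtLeast-□ : ∀ {g g' h h' k l} → DistAtLeast G g g' k → DistAtLeast H h h' l →
    DistAtLeast (G □ H) ⟨ g , h ⟩ ⟨ g' , h' ⟩ (k + l)
  DistAtLeast-□ {g} {g'} {h} {h'} distG distH j w with project w
  ... | k , l , refl , wG , wH =
    +-mono-≤ (distG k (subst₂ (λ a b → Walk G (proj₁ a) (proj₁ b) k) coords-x coords-y wG))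
             (distH l (subst₂ (λ a b → Walk H (proj₂ a) (proj₂ b) l) coords-x coords-y wH))
    where
    coords-x = remQuot-combine g h
    coords-y = remQuot-combine g' h'

  liftᴳ : ∀ {g g' k} h → Walk G g g' k → Walk (G □ H) ⟨ g , h ⟩ ⟨ g' , h ⟩ k
  liftᴳ h ε       = ε
  liftᴳ h (e ◅ w) = adj-□ (inj₁ (e , refl)) ◅ liftᴳ h w

  liftᴴ : ∀ {h h' k} g → Walk H h h' k → Walk (G □ H) ⟨ g , h ⟩ ⟨ g , h' ⟩ k
  liftᴴ g ε       = ε
  liftᴴ g (e ◅ w) = adj-□ (inj₂ (refl , e)) ◅ liftᴴ g w

  AllVertices-liftᴳ : ∀ {R g g' k} h (w : Walk G g g' k) →
    AllVertices (λ p → R ⟨ p , h ⟩) w → AllVertices R (liftᴳ h w)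
  AllVertices-liftᴳ h ε       r        = r
  AllVertices-liftᴳ h (_ ◅ w) (r , rs) = r , AllVertices-liftᴳ h w rs

  AllVertices-liftᴴ : ∀ {R h h' k} g (w : Walk H h h' k) →
    AllVertices (λ q → R ⟨ g , q ⟩) w → AllVertices R (liftᴴ g w)
  AllVertices-liftᴴ g ε       r        = r
  AllVertices-liftᴴ g (_ ◅ w) (r , rs) = r , AllVertices-liftᴴ g w rs

  module _ (S : Vertex (G □ H) → Set) where

    Clear-liftᴳ : ∀ {g g' k} h (w : Walk G g g' k) → Clear (λ p → S ⟨ p , h ⟩) w → Clear S (liftᴳ h w)
    Clear-liftᴳ h w = AllVertices-liftᴳ h w ∘ AllVertices-map (λ clear → Sum.map at-h at-h ∘ clear) w
      where at-h = cong (λ p → ⟨ p , h ⟩)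

    Clear-liftᴴ : ∀ {h h' k} g (w : Walk H h h' k) → Clear (λ q → S ⟨ g , q ⟩) w → Clear S (liftᴴ g w)
    Clear-liftᴴ g w = AllVertices-liftᴴ g w ∘ AllVertices-map (λ clear → Sum.map at-g at-g ∘ clear) w
      where at-g = cong (λ q → ⟨ g , q ⟩)

    ClearGeodesic-□ᴳᴴ : ∀ {g g' h h'} →
      ClearGeodesic G (λ p → S ⟨ p , h ⟩) g g' → ClearGeodesic H (λ q → S ⟨ g' , q ⟩) h h' →
      Unblocking S ⟨ g , h ⟩ ⟨ g' , h' ⟩ ⟨ g' , h ⟩ → ClearGeodesic (G □ H) S ⟨ g , h ⟩ ⟨ g' , h' ⟩
    ClearGeodesic-□ᴳᴴ {g' = g'} {h} (k , P , distP , clearP) (l , Q , distQ , clearQ) corner =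
      k + l , liftᴳ h P ◅◅ liftᴴ g' Q , DistAtLeast-□ distP distQ ,
      AllVertices-◅◅ (liftᴳ h P) (liftᴴ g' Q)
        (Clear-transfer S (liftᴳ h P) (λ _ → inj₁ refl) corner (Clear-liftᴳ h P clearP))
        (Clear-transfer S (liftᴴ g' Q) corner (λ _ → inj₂ refl) (Clear-liftᴴ g' Q clearQ))

    ClearGeodesic-□ᴴᴳ : ∀ {g g' h h'} →
      ClearGeodesic H (λ q → S ⟨ g , q ⟩) h h' → ClearGeodesic G (λ p → S ⟨ p , h' ⟩) g g' →
      Unblocking S ⟨ g , h ⟩ ⟨ g' , h' ⟩ ⟨ g , h' ⟩ → ClearGeodesic (G □ H) S ⟨ g , h ⟩ ⟨ g' , h' ⟩
    ClearGeodesic-□ᴴᴳ {g} {h' = h'} (l , Q , distQ , clearQ) (k , P , distP , clearP) corner =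
      l + k , liftᴴ g Q ◅◅ liftᴳ h' P ,
      subst (DistAtLeast _ _ _) (+-comm k l) (DistAtLeast-□ distP distQ) ,
      AllVertices-◅◅ (liftᴴ g Q) (liftᴳ h' P)
        (Clear-transfer S (liftᴴ g Q) (λ _ → inj₁ refl) corner (Clear-liftᴴ g Q clearQ))
        (Clear-transfer S (liftᴳ h' P) corner (λ _ → inj₂ refl) (Clear-liftᴳ h' P clearP))

    ClearGeodesic-□-detour : ∀ {g p g' h h' k l} (e : Adj G g p) (P : Walk G p g' k) →
      DistAtLeast G g g' (suc k) → AllVertices (Unblocking (λ p → S ⟨ p , h' ⟩) g g') P →
      (Q : Walk H h h' l) → DistAtLeast H h h' l → (∀ q → ¬ S ⟨ p , q ⟩) →
      ClearGeodesic (G □ H) S ⟨ g , h ⟩ ⟨ g' , h' ⟩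
    ClearGeodesic-□-detour {g} {p} {g'} {h} {h'} {k} {l} e P distP clearP Q distQ column-free =
      suc (l + k) , adj-□ (inj₁ (e , refl)) ◅ (liftᴴ p Q ◅◅ liftᴳ h' P) ,
      subst (DistAtLeast _ _ _) (cong suc (+-comm k l)) (DistAtLeast-□ distP distQ) ,
      (λ _ → inj₁ refl) ,
      AllVertices-◅◅ (liftᴴ p Q) (liftᴳ h' P)
        (AllVertices-liftᴴ p Q (AllVertices-universal (λ q s → ⊥-elim (column-free q s)) Q))
        (AllVertices-liftᴳ h' P
          (AllVertices-map reaches-end P (AllVertices-zip P clearP (geodesic-avoids-start e P distP))))
      where
      reaches-end : ∀ {p'} → Unblocking (λ p → S ⟨ p , h' ⟩) g g' p' × p' ≢ g →
        Unblocking S ⟨ g , h ⟩ ⟨ g' , h' ⟩ ⟨ p' , h' ⟩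
      reaches-end (clear , p'≢g) s with clear s
      ... | inj₁ p'≡g = ⊥-elim (p'≢g p'≡g)
      ... | inj₂ refl = inj₂ refl

infixr 7 _⊠_

-- A × B, with the pair (g , h) at index combine g h.

_⊠_ : ∀ {m k} → Subset m → Subset k → Subset (m * k)
[]            ⊠ B = []
(inside  ∷ A) ⊠ B = B ++ A ⊠ B
(outside ∷ A) ⊠ B = ⊥ ++ A ⊠ B

∣p++q∣ : ∀ {m k} (p : Subset m) (q : Subset k) → ∣ p ++ q ∣ ≡ ∣ p ∣ + ∣ q ∣
∣p++q∣ []            q = refl
∣p++q∣ (inside  ∷ p) q = cong suc (∣p++q∣ p q)
∣p++q∣ (outside ∷ p) q = ∣p++q∣ p q

∣A⊠B∣ : ∀ {m k} (A : Subset m) (B : Subset k) → ∣ A ⊠ B ∣ ≡ ∣ A ∣ * ∣ B ∣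
∣A⊠B∣         []            B = refl
∣A⊠B∣         (inside  ∷ A) B = trans (∣p++q∣ B (A ⊠ B)) (cong (∣ B ∣ +_) (∣A⊠B∣ A B))
∣A⊠B∣ {k = k} (outside ∷ A) B = trans (∣p++q∣ (⊥ {k}) (A ⊠ B)) (cong₂ _+_ (∣⊥∣≡0 k) (∣A⊠B∣ A B))

∈-++ˡ⁻ : ∀ {m k} (p : Subset m) (q : Subset k) i → i ↑ˡ k ∈ p ++ q → i ∈ p
∈-++ˡ⁻ (_ ∷ p) q zero    here       = here
∈-++ˡ⁻ (_ ∷ p) q (suc i) (there i∈) = there (∈-++ˡ⁻ p q i i∈)

∈-++ʳ⁻ : ∀ {m k} (p : Subset m) (q : Subset k) i → m ↑ʳ i ∈ p ++ q → i ∈ q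
∈-++ʳ⁻ []      q i i∈         = i∈
∈-++ʳ⁻ (_ ∷ p) q i (there i∈) = ∈-++ʳ⁻ p q i i∈

∈⊠⁻ : ∀ {m k} (A : Subset m) (B : Subset k) g h → combine g h ∈ A ⊠ B → g ∈ A × h ∈ B
∈⊠⁻ (inside  ∷ A) B zero    h gh∈ = here , ∈-++ˡ⁻ B (A ⊠ B) h gh∈
∈⊠⁻ (outside ∷ A) B zero    h gh∈ = ⊥-elim (∉⊥ (∈-++ˡ⁻ ⊥ (A ⊠ B) h gh∈))
∈⊠⁻ (inside  ∷ A) B (suc g) h gh∈ = map₁ there (∈⊠⁻ A B g h (∈-++ʳ⁻ B (A ⊠ B) _ gh∈))
∈⊠⁻ (outside ∷ A) B (suc g) h gh∈ = map₁ there (∈⊠⁻ A B g h (∈-++ʳ⁻ ⊥ (A ⊠ B) _ gh∈))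

∣p∣<∣p∪⁅x⁆∣ : ∀ {m} {p : Subset m} {x} → x ∉ p → ∣ p ∣ < ∣ p ∪ ⁅ x ⁆ ∣
∣p∣<∣p∪⁅x⁆∣ {x = x} x∉p = p⊂q⇒∣p∣<∣q∣ (p⊆p∪q ⁅ x ⁆ , x , x∈p∪q⁺ (inj₂ (x∈⁅x⁆ x)) , x∉p)

record BypassExtension (G : Graph) (A : Subset (n G)) : Set where
  field
    U             : Subset (n G)
    U-independent : IsIndependent G U
    A⊆U           : A ⊆ U
    u             : Vertex G
    u∈U           : u ∈ U
    u∉A           : u ∉ A
    u-bypass      : IsBypass G u

bypassOverVisible⇒extension : ∀ {G} → IsBypassOverVisible G →
  ∃[ A ] (IsMuTSet G A × BypassExtension G A)
bypassOverVisible⇒extension (U , independent , bypass , A , μt-set , A⊆U , u , u∈U , u∉A) =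
  A , μt-set ,
  record { U = U ; U-independent = independent ; A⊆U = A⊆U
         ; u = u ; u∈U = u∈U ; u∉A = u∉A ; u-bypass = bypass u u∈U }

module Construction (G H : Graph) (simpleG : IsSimple G) (simpleH : IsSimple H)
         {A : Subset (n G)} {B : Subset (n H)}
         (visibleA : IsTotalMutualVisibility G A) (visibleB : IsTotalMutualVisibility H B)
         (extA : BypassExtension G A) (extB : BypassExtension H B) where

  open Cartesian G H
  open BypassExtension extA using (u; u∉A; u-bypass)
    renaming (U to UG; U-independent to UG-independent; A⊆U to A⊆UG; u∈U to u∈UG)
  open BypassExtension extB using () renaming (u to v; u∉A to v∉B; u-bypass to v-bypass)

  X : Subset (n (G □ H))
  X = A ⊠ B ∪ ⁅ ⟨ u , v ⟩ ⁆

  ∈X⁻ : ∀ {g h} → ⟨ g , h ⟩ ∈ X → (g ∈ A × h ∈ B) ⊎ (g ≡ u × h ≡ v)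
  ∈X⁻ {g} {h} = Sum.map (∈⊠⁻ A B g h) (combine-injective g h u v ∘ x∈⁅y⁆⇒x≡y _) ∘ x∈p∪q⁻ _ _

  ∈X⇒∈UG : ∀ {g h} → ⟨ g , h ⟩ ∈ X → g ∈ UG
  ∈X⇒∈UG gh∈X with ∈X⁻ gh∈X
  ... | inj₁ (g∈A , _) = A⊆UG g∈A
  ... | inj₂ (refl , _) = u∈UG

  row-trace : ∀ h → (∀ {p} → ⟨ p , h ⟩ ∈ X → p ∈ A) ⊎ (∀ {p} → ⟨ p , h ⟩ ∈ X → p ≡ u)
  row-trace h with h ∈? B
  ... | yes h∈B = inj₁ ([ proj₁ , (λ { (_ , refl) → ⊥-elim (v∉B h∈B) }) ] ∘ ∈X⁻)
  ... | no  h∉B = inj₂ ([ (λ (_ , h∈B) → ⊥-elim (h∉B h∈B)) , proj₁ ] ∘ ∈X⁻)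

  column-trace : ∀ g → (∀ {q} → ⟨ g , q ⟩ ∈ X → q ∈ B) ⊎ (∀ {q} → ⟨ g , q ⟩ ∈ X → q ≡ v)
  column-trace g with g ∈? A
  ... | yes g∈A = inj₁ ([ proj₂ , (λ { (refl , _) → ⊥-elim (u∉A g∈A) }) ] ∘ ∈X⁻)
  ... | no  g∉A = inj₂ ([ (λ (g∈A , _) → ⊥-elim (g∉A g∈A)) , proj₂ ] ∘ ∈X⁻)

  row-geodesic : ∀ h g g' → ClearGeodesic G (λ p → ⟨ p , h ⟩ ∈ X) g g'
  row-geodesic h = fibre-geodesic simpleG visibleA u-bypass (row-trace h)

  column-geodesic : ∀ g h h' → ClearGeodesic H (λ q → ⟨ g , q ⟩ ∈ X) h h'
  column-geodesic g = fibre-geodesic simpleH visibleB v-bypass (column-trace g)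

  detour-geodesic : ∀ {g h g' h'} → g ∈ UG → g ≢ g' →
    ClearGeodesic (G □ H) (_∈ X) ⟨ g , h ⟩ ⟨ g' , h' ⟩
  detour-geodesic {g} {h} {g'} {h'} g∈UG g≢g' with row-geodesic h' g g'
  ... | _ , ε , _ , _ = ⊥-elim (g≢g' refl)
  ... | _ , _◅_ {y = p} e P , dist , (_ , clearP) with column-geodesic p h h'
  ...   | _ , Q , distQ , _ = ClearGeodesic-□-detour (_∈ X) e P dist clearP Q distQ column-free
    where
    column-free : ∀ q → ⟨ p , q ⟩ ∉ X
    column-free q pq∈X = UG-independent g p g∈UG (∈X⇒∈UG pq∈X) e

  geodesicᴳᴴ : ∀ g h g' h' → Unblocking (_∈ X) ⟨ g , h ⟩ ⟨ g' , h' ⟩ ⟨ g' , h ⟩ →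
    ClearGeodesic (G □ H) (_∈ X) ⟨ g , h ⟩ ⟨ g' , h' ⟩
  geodesicᴳᴴ g h g' h' = ClearGeodesic-□ᴳᴴ (_∈ X) (row-geodesic h g g') (column-geodesic g' h h')

  geodesicᴴᴳ : ∀ g h g' h' → Unblocking (_∈ X) ⟨ g , h ⟩ ⟨ g' , h' ⟩ ⟨ g , h' ⟩ →
    ClearGeodesic (G □ H) (_∈ X) ⟨ g , h ⟩ ⟨ g' , h' ⟩
  geodesicᴴᴳ g h g' h' = ClearGeodesic-□ᴴᴳ (_∈ X) (column-geodesic g h h') (row-geodesic h' g g')

  clear-geodesic : ∀ g h g' h' → ClearGeodesic (G □ H) (_∈ X) ⟨ g , h ⟩ ⟨ g' , h' ⟩
  clear-geodesic g h g' h' with ⟨ g' , h ⟩ ∈? X | ⟨ g , h' ⟩ ∈? X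
  ... | no  corner∉X | _           = geodesicᴳᴴ g h g' h' (⊥-elim ∘ corner∉X)
  ... | yes _        | no corner∉X = geodesicᴴᴳ g h g' h' (⊥-elim ∘ corner∉X)
  ... | yes _        | yes corner∈X with g ≟ g' | h ≟ h'
  ...   | yes refl | _        = geodesicᴳᴴ g h g h' (λ _ → inj₁ refl)
  ...   | no _     | yes refl = geodesicᴳᴴ g h g' h (λ _ → inj₂ refl)
  ...   | no g≢g'  | no _     = detour-geodesic (∈X⇒∈UG corner∈X) g≢g'

  X-totalMutualVisibility : IsTotalMutualVisibility (G □ H) X
  X-totalMutualVisibility x y =
    subst₂ (Visible (G □ H) X) (combine-remQuot {n G} (n H) x) (combine-remQuot {n G} (n H) y)
      (ClearGeodesic⇒visible (clear-geodesic _ _ _ _))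

  ∣A∣*∣B∣<∣X∣ : ∣ A ∣ * ∣ B ∣ < ∣ X ∣
  ∣A∣*∣B∣<∣X∣ = subst (_< ∣ X ∣) (∣A⊠B∣ A B) (∣p∣<∣p∪⁅x⁆∣ (u∉A ∘ proj₁ ∘ ∈⊠⁻ A B u v))

IsMuT⇒≤∣μt-set∣ : ∀ G {a A} → IsMuT G a → IsMuTSet G A → a ≤ ∣ A ∣
IsMuT⇒≤∣μt-set∣ _ ((Y , visibleY , refl) , _) (_ , maximal) = maximal Y visibleY

theorem5p2 : (G H : Graph) →
    IsSimple G → IsConnected G → IsSimple H → IsConnected H →
    IsBypassOverVisible G → IsBypassOverVisible H →
    ∀ (a b c : ℕ) → IsMuT G a → IsMuT H b → IsMuT (G □ H) c → a * b < c
theorem5p2 G H simpleG _ simpleH _ overG overH a b c μtG μtH (_ , maximal)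
  with bypassOverVisible⇒extension overG | bypassOverVisible⇒extension overH
... | A , A-μt@(visibleA , _) , extA | B , B-μt@(visibleB , _) , extB = begin-strict
  a * b         ≤⟨ *-mono-≤ (IsMuT⇒≤∣μt-set∣ G μtG A-μt) (IsMuT⇒≤∣μt-set∣ H μtH B-μt) ⟩
  ∣ A ∣ * ∣ B ∣ <⟨ ∣A∣*∣B∣<∣X∣ ⟩
  ∣ X ∣         ≤⟨ maximal X X-totalMutualVisibility ⟩
  c             ∎
  where
  open Construction G H simpleG simpleH visibleA visibleB extA extB
  open ≤-Reasoning
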